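{- Let $q\in\mathbb C^*$ and let $T_{i,j,k}$ ($i,j\in\mathbb Z$, $k\in\mathbb Z_{\ge0}$) be the solution of $$T_{i,j,k+1}T_{i,j,k-1}=q^j\,T_{i,j+1,k}T_{i,j-1,k}+q^i\,T_{i+1,j,k}T_{i-1,j,k}\qquad(k\ge1)$$ with initial data $T_{i,j,0}=T_{i,j,1}=1$ for all $i,j\in\mathbb Z$. Then $$T_{i,j,k}=q^{\frac{k(k-1)}{2}\min(i,j)}\prod_{m=1}^{\lfloor\frac{k-|i-j|}{2}\rfloor}\ \prod_{a=2m-k+|i-j|}^{k-|i-j|-2m}(1+q^a)\ \times\ \prod_{m=1}^{|i-j|}\ \prod_{a=m}^{k-|i-j|+2m-2}(1+q^a),$$ where empty products (including those with a negative upper limit for $m$ or an upper limit for $a$ smaller than the lower one) equal $1$. -}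

module Defs where

open import Level using (Level)
open import Algebra.Bundles using (CommutativeRing)
open import Data.Nat as ℕ using (ℕ; zero; suc; _∸_; _/_)
open import Data.Integer as ℤ using (ℤ; +_; -[1+_]; ∣_∣; _⊓_)

-- Everything below is relative to a commutative ring R and a chosen unit q
-- (q⁻ is meant to be its inverse; the theorem assumes q * q⁻ ≈ 1#).
module Ring {c ℓ : Level} (R : CommutativeRing c ℓ) where
  open CommutativeRing R

  natPow : Carrier → ℕ → Carrier
  natPow x zero    = 1#
  natPow x (suc n) = natPow x n * x

  zpow : (q q⁻ : Carrier) → ℤ → Carrier
  zpow q q⁻ (+ n)      = natPow q n
  zpow q q⁻ -[1+ n ]   = natPow q⁻ (suc n)

  prodN : ℕ → (ℕ → Carrier) → Carrier
  prodN zero    f = 1#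
  prodN (suc n) f = prodN n f * f n

  prod1to : ℕ → (ℕ → Carrier) → Carrier
  prod1to M g = prodN M (λ t → g (suc t))

  prodℤ : ℤ → ℤ → (ℤ → Carrier) → Carrier
  prodℤ lo hi f with hi ℤ.- lo
  ... | + n      = prodN (suc n) (λ t → f (lo ℤ.+ + t))
  ... | -[1+ _ ] = 1#

  formula : (q q⁻ : Carrier) → ℤ → ℤ → ℕ → Carrier
  formula q q⁻ i j k =
      zpow q q⁻ (+ ((k ℕ.* (k ∸ 1)) / 2) ℤ.* (i ⊓ j))
    * ( prod1to ((k ∸ d) / 2)
          (λ m → prodℤ (+ (2 ℕ.* m) ℤ.- + k ℤ.+ + d) (+ k ℤ.- + d ℤ.- + (2 ℕ.* m))
                       (λ a → 1# + zpow q q⁻ a))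
      * prod1to d
          (λ m → prodℤ (+ m) (+ k ℤ.- + d ℤ.+ + (2 ℕ.* m) ℤ.- + 2)
                       (λ a → 1# + zpow q q⁻ a)) )
    where d = ∣ i ℤ.- j ∣

module Submission where

-- A solution whose values are cancellable is determined by its layers k = 0, 1, so it
-- suffices that the formula is 1 on those layers and satisfies the recurrence.  Write the
-- formula as q^(C(k,2) min(i,j)) P(k, |i - j|).  Both sides are symmetric in i, j, so take
-- i = j + d.  The powers of q match because C(k+2,2) + C(k,2) = 2 C(k+1,2) + 1.  Raising
-- k and d by one multiplies P by the segment  prod_{a=d+1}^{k+d} (1 + q^a), whence
--   P(k+2,d) P(k,d) = (1 + q^d) P(k+1,d-1) P(k+1,d+1)      for d >= 1,
-- and splitting 1 + q^d gives the two terms of the recurrence.  For d = 0 the extra factor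
-- is prod_{a=-k}^{k} (1 + q^a), and q^(C(k+1,2)) times it is 2 (prod_{a=1}^{k} (1 + q^a))^2
-- because q^a (1 + q^-a) = 1 + q^a; the factor 2 accounts for the two equal terms.

open import Defs
open import Level using (Level)
open import Algebra.Bundles using (CommutativeRing)
open import Data.Nat as ℕ using (ℕ; zero; suc; _∸_; _/_; _<_; _≤_; z≤n; s≤s)
open import Data.Integer as ℤ using (ℤ; +_; -[1+_]; ∣_∣; _⊓_; 1ℤ; -1ℤ)
import Data.Nat.Properties as ℕP
import Data.Integer.Properties as ℤP
open import Data.Nat.DivMod using (m*n/n≡m; +-distrib-/-∣ˡ; +-distrib-/-∣ʳ)
open import Data.Nat.Divisibility using (∣-refl; n∣m*n)
import Data.Nat.Tactic.RingSolver as ℕ-Solver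
open import Data.Integer.Tactic.RingSolver using (solve-∀)
open import Data.Product using (Σ-syntax; _,_)
open import Data.Sum using (_⊎_; inj₁; inj₂)
open import Function using (_∘_)
open import Relation.Binary.PropositionalEquality as ≡ using (_≡_; cong; cong₂)

-- Arithmetic of exponents and bounds

binomial₂ : ℕ → ℕ
binomial₂ k = (k ℕ.* (k ∸ 1)) / 2

binomial₂-suc : ∀ k → binomial₂ (suc k) ≡ binomial₂ k ℕ.+ k
binomial₂-suc zero    = ≡.refl
binomial₂-suc (suc k) = begin
  (suc (suc k) ℕ.* suc k) / 2                 ≡⟨ cong (_/ 2) (expand k) ⟩
  (suc k ℕ.* k ℕ.+ suc k ℕ.* 2) / 2           ≡⟨ +-distrib-/-∣ʳ (suc k ℕ.* k) (n∣m*n (suc k)) ⟩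
  binomial₂ (suc k) ℕ.+ suc k ℕ.* 2 / 2       ≡⟨ cong (binomial₂ (suc k) ℕ.+_) (m*n/n≡m (suc k) 2) ⟩
  binomial₂ (suc k) ℕ.+ suc k                 ∎
  where
  open ≡.≡-Reasoning
  expand : ∀ k → suc (suc k) ℕ.* suc k ≡ suc k ℕ.* k ℕ.+ suc k ℕ.* 2
  expand = ℕ-Solver.solve-∀

half-suc-suc : ∀ k → suc (suc k) / 2 ≡ suc (k / 2)
half-suc-suc k = +-distrib-/-∣ˡ {2} k ∣-refl

+[2*m]≡+m++m : ∀ m → + (2 ℕ.* m) ≡ + m ℤ.+ + m
+[2*m]≡+m++m m = cong (λ n → + (m ℕ.+ n)) (ℕP.+-identityʳ m)

ℤ-as-difference : ∀ z → Σ[ m ∈ ℕ ] Σ[ n ∈ ℕ ] z ≡ + m ℤ.- + n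
ℤ-as-difference (+ m)    = m , 0 , ≡.sym (ℤP.+-identityʳ (+ m))
ℤ-as-difference -[1+ n ] = 0 , suc n , ≡.refl

difference-+ : ∀ m n m′ n′ → (+ m ℤ.- + n) ℤ.+ (+ m′ ℤ.- + n′) ≡ + (m ℕ.+ m′) ℤ.- + (n ℕ.+ n′)
difference-+ m n m′ n′ = ≡.trans (regroup (+ m) (+ n) (+ m′) (+ n′))
  (≡.sym (cong₂ ℤ._-_ (ℤP.pos-+ m m′) (ℤP.pos-+ n n′)))
  where
  regroup : ∀ M N M′ N′ → (M ℤ.- N) ℤ.+ (M′ ℤ.- N′) ≡ (M ℤ.+ M′) ℤ.- (N ℤ.+ N′)
  regroup = solve-∀

offset-trichotomy : ∀ i j → i ≡ j ⊎ Σ[ e ∈ ℕ ] i ≡ + suc e ℤ.+ j ⊎ Σ[ e ∈ ℕ ] j ≡ + suc e ℤ.+ i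
offset-trichotomy i j with i ℤ.- j in eq
... | + zero   = inj₁ (ℤP.i-j≡0⇒i≡j i j eq)
... | + suc e  = inj₂ (inj₁ (e , ≡.trans (I≡[I-J]+J i j) (cong (ℤ._+ j) eq)))
  where
  I≡[I-J]+J : ∀ I J → I ≡ (I ℤ.- J) ℤ.+ J
  I≡[I-J]+J = solve-∀
... | -[1+ e ] = inj₂ (inj₂ (e , ≡.trans (J≡-[I-J]+I i j) (cong (λ z → ℤ.- z ℤ.+ i) eq)))
  where
  J≡-[I-J]+I : ∀ I J → J ≡ ℤ.- (I ℤ.- J) ℤ.+ I
  J≡-[I-J]+I = solve-∀

exponent-diagonal : ∀ k s →
  + binomial₂ (suc (suc k)) ℤ.* s ℤ.+ + binomial₂ k ℤ.* s
  ≡ (s ℤ.+ (+ binomial₂ (suc k) ℤ.* s ℤ.+ + binomial₂ (suc k) ℤ.* ℤ.pred s)) ℤ.+ + binomial₂ (suc k)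
exponent-diagonal k s rewrite binomial₂-suc (suc k) | binomial₂-suc k = identity (+ binomial₂ k) (+ k) s
  where
  identity : ∀ B K S → ((B ℤ.+ K) ℤ.+ (1ℤ ℤ.+ K)) ℤ.* S ℤ.+ B ℤ.* S
                       ≡ (S ℤ.+ ((B ℤ.+ K) ℤ.* S ℤ.+ (B ℤ.+ K) ℤ.* (-1ℤ ℤ.+ S))) ℤ.+ (B ℤ.+ K)
  identity = solve-∀

exponent-offdiagonal : ∀ k j →
  + binomial₂ (suc (suc k)) ℤ.* j ℤ.+ + binomial₂ k ℤ.* j
  ≡ j ℤ.+ (+ binomial₂ (suc k) ℤ.* ℤ.suc j ℤ.+ + binomial₂ (suc k) ℤ.* ℤ.pred j)
exponent-offdiagonal k j rewrite binomial₂-suc (suc k) | binomial₂-suc k = identity (+ binomial₂ k) (+ k) j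
  where
  identity : ∀ B K J → ((B ℤ.+ K) ℤ.+ (1ℤ ℤ.+ K)) ℤ.* J ℤ.+ B ℤ.* J
                       ≡ J ℤ.+ ((B ℤ.+ K) ℤ.* (1ℤ ℤ.+ J) ℤ.+ (B ℤ.+ K) ℤ.* (-1ℤ ℤ.+ J))
  identity = solve-∀

-- Finite products and powers in a commutative ring

module _ {c ℓ : Level} (R : CommutativeRing c ℓ) where
  open CommutativeRing R
  open Ring R
  open import Relation.Binary.Reasoning.Setoid setoid
  open import Algebra.Solver.CommutativeMonoid *-commutativeMonoid using (solve; _⊜_; _⊕_)

  prodN-cong : ∀ n {f g : ℕ → Carrier} → (∀ t → t < n → f t ≈ g t) → prodN n f ≈ prodN n g
  prodN-cong zero    f≈g = refl
  prodN-cong (suc n) f≈g = *-cong (prodN-cong n (λ t t<n → f≈g t (ℕP.m<n⇒m<1+n t<n))) (f≈g n ℕP.≤-refl)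

  prodN-≈1# : ∀ n {f : ℕ → Carrier} → (∀ t → t < n → f t ≈ 1#) → prodN n f ≈ 1#
  prodN-≈1# n f≈1 = trans (prodN-cong n f≈1) (ones n)
    where
    ones : ∀ n → prodN n (λ _ → 1#) ≈ 1#
    ones zero    = refl
    ones (suc n) = trans (*-identityʳ _) (ones n)

  prodN-sucˡ : ∀ n (f : ℕ → Carrier) → prodN (suc n) f ≈ f 0 * prodN n (λ t → f (suc t))
  prodN-sucˡ zero    f = trans (*-identityˡ _) (sym (*-identityʳ _))
  prodN-sucˡ (suc n) f = begin
    prodN (suc n) f * f (suc n)                   ≈⟨ *-congʳ (prodN-sucˡ n f) ⟩
    (f 0 * prodN n (λ t → f (suc t))) * f (suc n) ≈⟨ *-assoc _ _ _ ⟩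
    f 0 * prodN (suc n) (λ t → f (suc t))         ∎

  prodℤ-nonempty : ∀ lo hi (f : ℤ → Carrier) n → hi ℤ.- lo ≡ + n →
                   prodℤ lo hi f ≈ prodN (suc n) (λ t → f (lo ℤ.+ + t))
  prodℤ-nonempty lo hi f n eq with hi ℤ.- lo
  prodℤ-nonempty lo hi f n ≡.refl | .(+ n) = refl

  prodℤ-empty : ∀ lo hi (f : ℤ → Carrier) n → hi ℤ.- lo ≡ -[1+ n ] → prodℤ lo hi f ≈ 1#
  prodℤ-empty lo hi f n eq with hi ℤ.- lo
  prodℤ-empty lo hi f n ≡.refl | .(-[1+ n ]) = refl

  prodℤ-cong-bounds : ∀ (f : ℤ → Carrier) {lo lo′ hi hi′} → lo ≡ lo′ → hi ≡ hi′ →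
                      prodℤ lo hi f ≈ prodℤ lo′ hi′ f
  prodℤ-cong-bounds f ≡.refl ≡.refl = refl

  prodℤ-sucˡ : ∀ lo n (f : ℤ → Carrier) →
               prodℤ lo (lo ℤ.+ + n) f ≈ f lo * prodℤ (ℤ.suc lo) (lo ℤ.+ + n) f
  prodℤ-sucˡ lo zero f = begin
    prodℤ lo (lo ℤ.+ + 0) f                  ≈⟨ prodℤ-nonempty lo (lo ℤ.+ + 0) f 0 ([L+0]-L≡0 lo) ⟩
    1# * f (lo ℤ.+ + 0)                      ≈⟨ *-identityˡ _ ⟩
    f (lo ℤ.+ + 0)                           ≡⟨ cong f (ℤP.+-identityʳ lo) ⟩
    f lo                                     ≈⟨ *-identityʳ _ ⟨
    f lo * 1#                                ≈⟨ *-congˡ (prodℤ-empty (ℤ.suc lo) (lo ℤ.+ + 0) f 0 ([L+0]-[1+L]≡-1 lo)) ⟨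
    f lo * prodℤ (ℤ.suc lo) (lo ℤ.+ + 0) f   ∎
    where
    [L+0]-L≡0 : ∀ L → (L ℤ.+ + 0) ℤ.- L ≡ + 0
    [L+0]-L≡0 = solve-∀
    [L+0]-[1+L]≡-1 : ∀ L → (L ℤ.+ + 0) ℤ.- (1ℤ ℤ.+ L) ≡ -1ℤ
    [L+0]-[1+L]≡-1 = solve-∀
  prodℤ-sucˡ lo (suc n) f = begin
    prodℤ lo (lo ℤ.+ + suc n) f
      ≈⟨ prodℤ-nonempty lo (lo ℤ.+ + suc n) f (suc n) ([L+[1+N]]-L≡1+N lo (+ n)) ⟩
    prodN (suc (suc n)) (λ t → f (lo ℤ.+ + t))
      ≈⟨ prodN-sucˡ (suc n) _ ⟩
    f (lo ℤ.+ + 0) * prodN (suc n) (λ t → f (lo ℤ.+ + suc t))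
      ≈⟨ *-cong (reflexive (cong f (ℤP.+-identityʳ lo)))
                (prodN-cong (suc n) (λ t _ → reflexive (cong f (L+[1+T]≡[1+L]+T lo (+ t))))) ⟩
    f lo * prodN (suc n) (λ t → f (ℤ.suc lo ℤ.+ + t))
      ≈⟨ *-congˡ (prodℤ-nonempty (ℤ.suc lo) (lo ℤ.+ + suc n) f n ([L+[1+N]]-[1+L]≡N lo (+ n))) ⟨
    f lo * prodℤ (ℤ.suc lo) (lo ℤ.+ + suc n) f ∎
    where
    [L+[1+N]]-L≡1+N : ∀ L N → (L ℤ.+ (1ℤ ℤ.+ N)) ℤ.- L ≡ 1ℤ ℤ.+ N
    [L+[1+N]]-L≡1+N = solve-∀
    [L+[1+N]]-[1+L]≡N : ∀ L N → (L ℤ.+ (1ℤ ℤ.+ N)) ℤ.- (1ℤ ℤ.+ L) ≡ N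
    [L+[1+N]]-[1+L]≡N = solve-∀
    L+[1+T]≡[1+L]+T : ∀ L T → L ℤ.+ (1ℤ ℤ.+ T) ≡ (1ℤ ℤ.+ L) ℤ.+ T
    L+[1+T]≡[1+L]+T = solve-∀

  natPow-+ : ∀ x m n → natPow x (m ℕ.+ n) ≈ natPow x m * natPow x n
  natPow-+ x zero    n = sym (*-identityˡ _)
  natPow-+ x (suc m) n = begin
    natPow x (m ℕ.+ n) * x        ≈⟨ *-congʳ (natPow-+ x m n) ⟩
    (natPow x m * natPow x n) * x ≈⟨ solve 3 (λ a b y → (a ⊕ b) ⊕ y ⊜ (a ⊕ y) ⊕ b) refl _ _ _ ⟩
    (natPow x m * x) * natPow x n ∎

  natPow-inverse : ∀ {x y} → x * y ≈ 1# → ∀ m → natPow x m * natPow y m ≈ 1#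
  natPow-inverse x*y≈1 zero    = *-identityˡ 1#
  natPow-inverse {x} {y} x*y≈1 (suc m) = begin
    (natPow x m * x) * (natPow y m * y) ≈⟨ solve 4 (λ a b u v → (a ⊕ u) ⊕ (b ⊕ v) ⊜ (a ⊕ b) ⊕ (u ⊕ v)) refl _ _ _ _ ⟩
    (natPow x m * natPow y m) * (x * y) ≈⟨ *-cong (natPow-inverse x*y≈1 m) x*y≈1 ⟩
    1# * 1#                             ≈⟨ *-identityˡ 1# ⟩
    1#                                  ∎

  module _ (q q⁻ : Carrier) (q*q⁻≈1 : q * q⁻ ≈ 1#) where

    q^_ : ℤ → Carrier
    q^_ = zpow q q⁻

    1+q^_ : ℤ → Carrier
    1+q^ a = 1# + q^ a

    q^-difference : ∀ m n → q^ (+ m ℤ.- + n) ≈ natPow q m * natPow q⁻ n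
    q^-difference m       zero    = trans (reflexive (cong q^_ (ℤP.+-identityʳ (+ m)))) (sym (*-identityʳ _))
    q^-difference zero    (suc n) = sym (*-identityˡ _)
    q^-difference (suc m) (suc n) = begin
      q^ (+ suc m ℤ.- + suc n)                ≡⟨ cong q^_ ([1+M]-[1+N]≡M-N (+ m) (+ n)) ⟩
      q^ (+ m ℤ.- + n)                        ≈⟨ q^-difference m n ⟩
      natPow q m * natPow q⁻ n                ≈⟨ *-identityʳ _ ⟨
      (natPow q m * natPow q⁻ n) * 1#         ≈⟨ *-congˡ q*q⁻≈1 ⟨
      (natPow q m * natPow q⁻ n) * (q * q⁻)   ≈⟨ solve 4 (λ a b u v → (a ⊕ b) ⊕ (u ⊕ v) ⊜ (a ⊕ u) ⊕ (b ⊕ v)) refl _ _ _ _ ⟩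
      (natPow q m * q) * (natPow q⁻ n * q⁻)   ∎
      where
      [1+M]-[1+N]≡M-N : ∀ M N → (1ℤ ℤ.+ M) ℤ.- (1ℤ ℤ.+ N) ≡ M ℤ.- N
      [1+M]-[1+N]≡M-N = solve-∀

    q^-homo : ∀ a b → q^ (a ℤ.+ b) ≈ q^ a * q^ b
    q^-homo a b with ℤ-as-difference a | ℤ-as-difference b
    ... | m , n , ≡.refl | m′ , n′ , ≡.refl = begin
      q^ ((+ m ℤ.- + n) ℤ.+ (+ m′ ℤ.- + n′))                ≡⟨ cong q^_ (difference-+ m n m′ n′) ⟩
      q^ (+ (m ℕ.+ m′) ℤ.- + (n ℕ.+ n′))                    ≈⟨ q^-difference (m ℕ.+ m′) (n ℕ.+ n′) ⟩
      natPow q (m ℕ.+ m′) * natPow q⁻ (n ℕ.+ n′)           ≈⟨ *-cong (natPow-+ q m m′) (natPow-+ q⁻ n n′) ⟩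
      (natPow q m * natPow q m′) * (natPow q⁻ n * natPow q⁻ n′)
        ≈⟨ solve 4 (λ x y u v → (x ⊕ y) ⊕ (u ⊕ v) ⊜ (x ⊕ u) ⊕ (y ⊕ v)) refl _ _ _ _ ⟩
      (natPow q m * natPow q⁻ n) * (natPow q m′ * natPow q⁻ n′)
        ≈⟨ *-cong (q^-difference m n) (q^-difference m′ n′) ⟨
      q^ (+ m ℤ.- + n) * q^ (+ m′ ℤ.- + n′)                 ∎

    q^-pair : ∀ v w A B → (q^ v * A) * (q^ w * B) ≈ q^ (v ℤ.+ w) * (A * B)
    q^-pair v w A B = begin
      (q^ v * A) * (q^ w * B) ≈⟨ solve 4 (λ a b x y → (a ⊕ x) ⊕ (b ⊕ y) ⊜ (a ⊕ b) ⊕ (x ⊕ y)) refl _ _ _ _ ⟩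
      (q^ v * q^ w) * (A * B) ≈⟨ *-congʳ (q^-homo v w) ⟨
      q^ (v ℤ.+ w) * (A * B)  ∎

    q^-triple : ∀ u v w A B → q^ u * ((q^ v * A) * (q^ w * B)) ≈ q^ (u ℤ.+ (v ℤ.+ w)) * (A * B)
    q^-triple u v w A B = begin
      q^ u * ((q^ v * A) * (q^ w * B)) ≈⟨ *-congˡ (q^-pair v w A B) ⟩
      q^ u * (q^ (v ℤ.+ w) * (A * B))  ≈⟨ *-assoc _ _ _ ⟨
      (q^ u * q^ (v ℤ.+ w)) * (A * B)  ≈⟨ *-congʳ (q^-homo u (v ℤ.+ w)) ⟨
      q^ (u ℤ.+ (v ℤ.+ w)) * (A * B)   ∎

    qⁿ[1+q⁻ⁿ]≈1+qⁿ : ∀ n → natPow q n * (1# + natPow q⁻ n) ≈ 1# + natPow q n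
    qⁿ[1+q⁻ⁿ]≈1+qⁿ n = begin
      natPow q n * (1# + natPow q⁻ n)           ≈⟨ distribˡ _ _ _ ⟩
      natPow q n * 1# + natPow q n * natPow q⁻ n ≈⟨ +-cong (*-identityʳ _) (natPow-inverse q*q⁻≈1 n) ⟩
      natPow q n + 1#                           ≈⟨ +-comm _ _ ⟩
      1# + natPow q n                           ∎

    P₁ P₂ P : ℕ → ℕ → Carrier
    P₁ k d = prod1to ((k ∸ d) / 2)
               (λ m → prodℤ (+ (2 ℕ.* m) ℤ.- + k ℤ.+ + d) (+ k ℤ.- + d ℤ.- + (2 ℕ.* m)) 1+q^_)
    P₂ k d = prod1to d (λ m → prodℤ (+ m) (+ k ℤ.- + d ℤ.+ + (2 ℕ.* m) ℤ.- + 2) 1+q^_)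
    P k d  = P₁ k d * P₂ k d

    -- F (i ⊓ j) ∣ i - j ∣ k is formula q q⁻ i j k by definition.
    F : ℤ → ℕ → ℕ → Carrier
    F s d k = q^ (+ binomial₂ k ℤ.* s) * P k d

    segment : ℕ → ℕ → Carrier
    segment k d = prodℤ (+ suc d) (+ k ℤ.+ + d) 1+q^_

    P₁-shift : ∀ k d → P₁ (suc k) (suc d) ≈ P₁ k d
    P₁-shift k d = prodN-cong ((k ∸ d) / 2) (λ t _ → prodℤ-cong-bounds 1+q^_
      (lower (+ (2 ℕ.* suc t)) (+ k) (+ d)) (upper (+ (2 ℕ.* suc t)) (+ k) (+ d)))
      where
      lower : ∀ W K D → W ℤ.- (1ℤ ℤ.+ K) ℤ.+ (1ℤ ℤ.+ D) ≡ W ℤ.- K ℤ.+ D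
      lower = solve-∀
      upper : ∀ W K D → (1ℤ ℤ.+ K) ℤ.- (1ℤ ℤ.+ D) ℤ.- W ≡ K ℤ.- D ℤ.- W
      upper = solve-∀

    P₂-shift : ∀ k d → P₂ (suc k) (suc d) ≈ P₂ k d * segment k d
    P₂-shift k d = *-cong
      (prodN-cong d (λ t _ → prodℤ-cong-bounds 1+q^_ ≡.refl (inner (+ (2 ℕ.* suc t)) (+ k) (+ d))))
      (prodℤ-cong-bounds 1+q^_ ≡.refl
        (≡.trans (cong (λ W → + suc k ℤ.- + suc d ℤ.+ W ℤ.- + 2) (+[2*m]≡+m++m (suc d))) (last (+ k) (+ d))))
      where
      inner : ∀ W K D → (1ℤ ℤ.+ K) ℤ.- (1ℤ ℤ.+ D) ℤ.+ W ℤ.- + 2 ≡ K ℤ.- D ℤ.+ W ℤ.- + 2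
      inner = solve-∀
      last : ∀ K D → (1ℤ ℤ.+ K) ℤ.- (1ℤ ℤ.+ D) ℤ.+ ((1ℤ ℤ.+ D) ℤ.+ (1ℤ ℤ.+ D)) ℤ.- + 2 ≡ K ℤ.+ D
      last = solve-∀

    P-shift : ∀ k d → P (suc k) (suc d) ≈ P k d * segment k d
    P-shift k d = trans (*-cong (P₁-shift k d) (P₂-shift k d)) (sym (*-assoc _ _ _))

    segment-sucˡ : ∀ k e → segment (suc k) e ≈ 1+q^ (+ suc e) * segment k (suc e)
    segment-sucˡ k e = begin
      prodℤ (+ suc e) (+ suc k ℤ.+ + e) 1+q^_
        ≡⟨ cong (λ hi → prodℤ (+ suc e) hi 1+q^_) (cong (+_ ∘ suc) (ℕP.+-comm k e)) ⟩
      prodℤ (+ suc e) (+ suc e ℤ.+ + k) 1+q^_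
        ≈⟨ prodℤ-sucˡ (+ suc e) k 1+q^_ ⟩
      1+q^ (+ suc e) * prodℤ (+ suc (suc e)) (+ suc e ℤ.+ + k) 1+q^_
        ≡⟨ cong (λ hi → 1+q^ (+ suc e) * prodℤ (+ suc (suc e)) hi 1+q^_) (ℤP.+-comm (+ suc e) (+ k)) ⟩
      1+q^ (+ suc e) * segment k (suc e) ∎

    P-offdiagonal : ∀ k e → P (suc (suc k)) (suc e) * P k (suc e)
                            ≈ (P (suc k) e * P (suc k) (suc (suc e))) * 1+q^ (+ suc e)
    P-offdiagonal k e = begin
      P (suc (suc k)) (suc e) * P k (suc e)
        ≈⟨ *-congʳ (P-shift (suc k) e) ⟩
      (P (suc k) e * segment (suc k) e) * P k (suc e)
        ≈⟨ *-congʳ (*-congˡ (segment-sucˡ k e)) ⟩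
      (P (suc k) e * (1+q^ (+ suc e) * segment k (suc e))) * P k (suc e)
        ≈⟨ solve 4 (λ a x s b → (a ⊕ (x ⊕ s)) ⊕ b ⊜ (a ⊕ (b ⊕ s)) ⊕ x) refl _ _ _ _ ⟩
      (P (suc k) e * (P k (suc e) * segment k (suc e))) * 1+q^ (+ suc e)
        ≈⟨ *-congʳ (*-congˡ (P-shift k (suc e))) ⟨
      (P (suc k) e * P (suc k) (suc (suc e))) * 1+q^ (+ suc e) ∎

    P₁-initial : ∀ {k} d → k ≤ 1 → P₁ k d ≈ 1#
    P₁-initial zero          z≤n       = refl
    P₁-initial (suc d)       z≤n       = refl
    P₁-initial zero          (s≤s z≤n) = refl
    P₁-initial (suc zero)    (s≤s z≤n) = refl
    P₁-initial (suc (suc d)) (s≤s z≤n) = refl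

    P₂-initial : ∀ {k} d → k ≤ 1 → P₂ k d ≈ 1#
    P₂-initial {k} d k≤1 = prodN-≈1# d (λ t t<d →
      prodℤ-empty (+ suc t) (+ k ℤ.- + d ℤ.+ + (2 ℕ.* suc t) ℤ.- + 2) 1+q^_ _
        (≡.trans (cong (λ D → (+ k ℤ.- + D ℤ.+ + (2 ℕ.* suc t) ℤ.- + 2) ℤ.- + suc t) (≡.sym (ℕP.m+[n∸m]≡n t<d)))
                 (gap t (d ∸ suc t))))
      where
      K-[2+U]≡-[1+[1∸K]+U] : ∀ {k} u → k ≤ 1 → + k ℤ.- + suc (suc u) ≡ -[1+ (1 ∸ k) ℕ.+ u ]
      K-[2+U]≡-[1+[1∸K]+U] u z≤n       = ≡.refl
      K-[2+U]≡-[1+[1∸K]+U] u (s≤s z≤n) = ≡.refl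
      collapse : ∀ K T U → (K ℤ.- ((1ℤ ℤ.+ T) ℤ.+ U) ℤ.+ ((1ℤ ℤ.+ T) ℤ.+ (1ℤ ℤ.+ T)) ℤ.- + 2) ℤ.- (1ℤ ℤ.+ T)
                       ≡ K ℤ.- (+ 2 ℤ.+ U)
      collapse = solve-∀
      gap : ∀ t u → (+ k ℤ.- + (suc t ℕ.+ u) ℤ.+ + (2 ℕ.* suc t) ℤ.- + 2) ℤ.- + suc t ≡ -[1+ (1 ∸ k) ℕ.+ u ]
      gap t u rewrite +[2*m]≡+m++m (suc t) = ≡.trans (collapse (+ k) (+ t) (+ u)) (K-[2+U]≡-[1+[1∸K]+U] u k≤1)

    P-initial : ∀ {k} d → k ≤ 1 → P k d ≈ 1#
    P-initial d k≤1 = trans (*-cong (P₁-initial d k≤1) (P₂-initial d k≤1)) (*-identityˡ 1#)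

    symProd posProd : ℕ → Carrier
    symProd k = prodℤ (ℤ.- + k) (+ k) 1+q^_
    posProd k = prodN k (λ t → 1+q^ (+ suc t))

    segment-zero : ∀ k → segment k 0 ≈ posProd k
    segment-zero zero    = prodℤ-empty (+ 1) (+ 0 ℤ.+ + 0) 1+q^_ 0 ≡.refl
    segment-zero (suc k) = prodℤ-nonempty (+ 1) (+ suc k ℤ.+ + 0) 1+q^_ k ([1+K]+0-1≡K (+ k))
      where
      [1+K]+0-1≡K : ∀ K → (1ℤ ℤ.+ K) ℤ.+ + 0 ℤ.- 1ℤ ≡ K
      [1+K]+0-1≡K = solve-∀

    symProd-suc : ∀ k → symProd (suc k) ≈ (1+q^ -[1+ k ] * symProd k) * 1+q^ (+ suc k)
    symProd-suc k = begin
      symProd (suc k)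
        ≈⟨ as-prodN (suc k) ⟩
      prodN (suc (suc k ℕ.+ suc k)) f
        ≡⟨ cong (λ n → prodN (suc (suc n)) f) (ℕP.+-suc k k) ⟩
      prodN (suc (suc (k ℕ.+ k))) f * f (suc (suc (k ℕ.+ k)))
        ≈⟨ *-cong (prodN-sucˡ (suc (k ℕ.+ k)) f) (reflexive (cong 1+q^_ (last (+ k)))) ⟩
      (f 0 * prodN (suc (k ℕ.+ k)) (λ t → f (suc t))) * 1+q^ (+ suc k)
        ≈⟨ *-congʳ (*-cong (reflexive (cong 1+q^_ (ℤP.+-identityʳ -[1+ k ])))
                           (prodN-cong (suc (k ℕ.+ k)) (λ t _ → reflexive (cong 1+q^_ (shift (+ k) (+ t)))))) ⟩
      (1+q^ -[1+ k ] * prodN (suc (k ℕ.+ k)) (λ t → 1+q^ (ℤ.- + k ℤ.+ + t))) * 1+q^ (+ suc k)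
        ≈⟨ *-congʳ (*-congˡ (as-prodN k)) ⟨
      (1+q^ -[1+ k ] * symProd k) * 1+q^ (+ suc k) ∎
      where
      f : ℕ → Carrier
      f t = 1+q^ (-[1+ k ] ℤ.+ + t)
      K--K≡K+K : ∀ K → K ℤ.- ℤ.- K ≡ K ℤ.+ K
      K--K≡K+K = solve-∀
      as-prodN : ∀ k → symProd k ≈ prodN (suc (k ℕ.+ k)) (λ t → 1+q^ (ℤ.- + k ℤ.+ + t))
      as-prodN k = prodℤ-nonempty (ℤ.- + k) (+ k) 1+q^_ (k ℕ.+ k) (K--K≡K+K (+ k))
      last : ∀ K → ℤ.- (1ℤ ℤ.+ K) ℤ.+ (1ℤ ℤ.+ (1ℤ ℤ.+ (K ℤ.+ K))) ≡ 1ℤ ℤ.+ K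
      last = solve-∀
      shift : ∀ K T → ℤ.- (1ℤ ℤ.+ K) ℤ.+ (1ℤ ℤ.+ T) ≡ ℤ.- K ℤ.+ T
      shift = solve-∀

    P₁-diagonal : ∀ k → P₁ (suc (suc k)) 0 ≈ symProd k * P₁ k 0
    P₁-diagonal k = begin
      P₁ (suc (suc k)) 0
        ≡⟨ cong (λ n → prodN n (g ∘ suc)) (half-suc-suc k) ⟩
      prodN (suc (k / 2)) (g ∘ suc)
        ≈⟨ prodN-sucˡ (k / 2) (g ∘ suc) ⟩
      g 1 * prodN (k / 2) (g ∘ suc ∘ suc)
        ≈⟨ *-cong (prodℤ-cong-bounds 1+q^_ (first-lower (+ k)) (first-upper (+ k)))
                  (prodN-cong (k / 2) (λ t _ → prodℤ-cong-bounds 1+q^_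
                     (≡.trans (cong (λ W → W ℤ.- + suc (suc k) ℤ.+ + 0) (double-suc (suc t))) (lower (+ (2 ℕ.* suc t)) (+ k)))
                     (≡.trans (cong (λ W → + suc (suc k) ℤ.- + 0 ℤ.- W) (double-suc (suc t))) (upper (+ (2 ℕ.* suc t)) (+ k))))) ⟩
      symProd k * P₁ k 0 ∎
      where
      g : ℕ → Carrier
      g m = prodℤ (+ (2 ℕ.* m) ℤ.- + suc (suc k) ℤ.+ + 0) (+ suc (suc k) ℤ.- + 0 ℤ.- + (2 ℕ.* m)) 1+q^_
      double-suc : ∀ t → + (2 ℕ.* suc t) ≡ + (2 ℕ.* t) ℤ.+ + 2
      double-suc t = cong +_ (≡.trans (ℕP.*-suc 2 t) (ℕP.+-comm 2 (2 ℕ.* t)))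
      first-lower : ∀ K → + 2 ℤ.- (+ 2 ℤ.+ K) ℤ.+ + 0 ≡ ℤ.- K
      first-lower = solve-∀
      first-upper : ∀ K → (+ 2 ℤ.+ K) ℤ.- + 0 ℤ.- + 2 ≡ K
      first-upper = solve-∀
      lower : ∀ W K → (W ℤ.+ + 2) ℤ.- (+ 2 ℤ.+ K) ℤ.+ + 0 ≡ W ℤ.- K ℤ.+ + 0
      lower = solve-∀
      upper : ∀ W K → (+ 2 ℤ.+ K) ℤ.- + 0 ℤ.- (W ℤ.+ + 2) ≡ K ℤ.- + 0 ℤ.- W
      upper = solve-∀

    symProd-identity : ∀ k → natPow q (binomial₂ (suc k)) * symProd k ≈ (1# + 1#) * (posProd k * posProd k)
    symProd-identity zero = begin
      1# * (1# * (1# + 1#))   ≈⟨ trans (*-identityˡ _) (*-identityˡ _) ⟩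
      1# + 1#                 ≈⟨ *-identityʳ _ ⟨
      (1# + 1#) * 1#          ≈⟨ *-congˡ (*-identityˡ 1#) ⟨
      (1# + 1#) * (1# * 1#)   ∎
    symProd-identity (suc k) = begin
      natPow q (binomial₂ (suc (suc k))) * symProd (suc k)
        ≡⟨ cong (λ n → natPow q n * symProd (suc k)) (binomial₂-suc (suc k)) ⟩
      natPow q (binomial₂ (suc k) ℕ.+ suc k) * symProd (suc k)
        ≈⟨ *-cong (natPow-+ q (binomial₂ (suc k)) (suc k)) (symProd-suc k) ⟩
      (natPow q (binomial₂ (suc k)) * natPow q (suc k)) * ((1+q^ -[1+ k ] * symProd k) * 1+q^ (+ suc k))
        ≈⟨ solve 5 (λ a b x s y → (a ⊕ b) ⊕ ((x ⊕ s) ⊕ y) ⊜ (a ⊕ s) ⊕ ((b ⊕ x) ⊕ y)) refl _ _ _ _ _ ⟩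
      (natPow q (binomial₂ (suc k)) * symProd k) * ((natPow q (suc k) * 1+q^ -[1+ k ]) * 1+q^ (+ suc k))
        ≈⟨ *-cong (symProd-identity k) (*-congʳ (qⁿ[1+q⁻ⁿ]≈1+qⁿ (suc k))) ⟩
      ((1# + 1#) * (posProd k * posProd k)) * (1+q^ (+ suc k) * 1+q^ (+ suc k))
        ≈⟨ solve 4 (λ t h x y → (t ⊕ (h ⊕ h)) ⊕ (x ⊕ y) ⊜ t ⊕ ((h ⊕ x) ⊕ (h ⊕ y))) refl _ _ _ _ ⟩
      (1# + 1#) * (posProd (suc k) * posProd (suc k)) ∎

    P-diagonal : ∀ k → natPow q (binomial₂ (suc k)) * (P (suc (suc k)) 0 * P k 0)
                       ≈ P (suc k) 1 * P (suc k) 1 + P (suc k) 1 * P (suc k) 1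
    P-diagonal k = begin
      natPow q (binomial₂ (suc k)) * ((P₁ (suc (suc k)) 0 * 1#) * (X * 1#))
        ≈⟨ *-congˡ (*-cong (trans (*-identityʳ _) (P₁-diagonal k)) (*-identityʳ X)) ⟩
      natPow q (binomial₂ (suc k)) * ((symProd k * X) * X)
        ≈⟨ solve 3 (λ n s x → n ⊕ ((s ⊕ x) ⊕ x) ⊜ (n ⊕ s) ⊕ (x ⊕ x)) refl _ _ _ ⟩
      (natPow q (binomial₂ (suc k)) * symProd k) * (X * X)
        ≈⟨ *-congʳ (symProd-identity k) ⟩
      ((1# + 1#) * (posProd k * posProd k)) * (X * X)
        ≈⟨ solve 4 (λ t h x y → (t ⊕ (h ⊕ h)) ⊕ (x ⊕ y) ⊜ t ⊕ ((x ⊕ h) ⊕ (y ⊕ h))) refl _ _ _ _ ⟩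
      (1# + 1#) * ((X * posProd k) * (X * posProd k))
        ≈⟨ trans (distribʳ _ 1# 1#) (+-cong (*-identityˡ _) (*-identityˡ _)) ⟩
      (X * posProd k) * (X * posProd k) + (X * posProd k) * (X * posProd k)
        ≈⟨ +-cong (*-cong P[1+k,1] P[1+k,1]) (*-cong P[1+k,1] P[1+k,1]) ⟨
      P (suc k) 1 * P (suc k) 1 + P (suc k) 1 * P (suc k) 1 ∎
      where
      X : Carrier
      X = P₁ k 0
      P[1+k,1] : P (suc k) 1 ≈ X * posProd k
      P[1+k,1] = trans (P-shift k 0) (*-cong (*-identityʳ X) (segment-zero k))

    F-initial : ∀ s d {k} → k ≤ 1 → F s d k ≈ 1#
    F-initial s d z≤n       = trans (*-identityˡ _) (P-initial d z≤n)
    F-initial s d (s≤s z≤n) = trans (*-identityˡ _) (P-initial d (s≤s z≤n))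

    F-diagonal : ∀ s k →
      F s 0 (suc (suc k)) * F s 0 k
      ≈ q^ s * (F s 1 (suc k) * F (ℤ.pred s) 1 (suc k)) + q^ s * (F s 1 (suc k) * F (ℤ.pred s) 1 (suc k))
    F-diagonal s k = begin
      F s 0 (suc (suc k)) * F s 0 k
        ≈⟨ q^-pair (+ binomial₂ (suc (suc k)) ℤ.* s) (+ binomial₂ k ℤ.* s) _ _ ⟩
      q^ (+ binomial₂ (suc (suc k)) ℤ.* s ℤ.+ + binomial₂ k ℤ.* s) * (P (suc (suc k)) 0 * P k 0)
        ≡⟨ cong (λ z → q^ z * (P (suc (suc k)) 0 * P k 0)) (exponent-diagonal k s) ⟩
      q^ (r ℤ.+ + b) * (P (suc (suc k)) 0 * P k 0)
        ≈⟨ *-congʳ (q^-homo r (+ b)) ⟩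
      (q^ r * natPow q b) * (P (suc (suc k)) 0 * P k 0)
        ≈⟨ *-assoc _ _ _ ⟩
      q^ r * (natPow q b * (P (suc (suc k)) 0 * P k 0))
        ≈⟨ *-congˡ (P-diagonal k) ⟩
      q^ r * (Y + Y)
        ≈⟨ distribˡ _ _ _ ⟩
      q^ r * Y + q^ r * Y
        ≈⟨ +-cong (q^-triple s x y _ _) (q^-triple s x y _ _) ⟨
      q^ s * (F s 1 (suc k) * F (ℤ.pred s) 1 (suc k)) + q^ s * (F s 1 (suc k) * F (ℤ.pred s) 1 (suc k)) ∎
      where
      b : ℕ
      b = binomial₂ (suc k)
      x y r : ℤ
      x = + b ℤ.* s
      y = + b ℤ.* ℤ.pred s
      r = s ℤ.+ (x ℤ.+ y)
      Y : Carrier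
      Y = P (suc k) 1 * P (suc k) 1

    F-offdiagonal : ∀ j e k →
      F j (suc e) (suc (suc k)) * F j (suc e) k
      ≈ q^ j * (F (ℤ.suc j) e (suc k) * F (ℤ.pred j) (suc (suc e)) (suc k))
        + q^ (+ suc e ℤ.+ j) * (F j (suc (suc e)) (suc k) * F j e (suc k))
    F-offdiagonal j e k = begin
      F j (suc e) (suc (suc k)) * F j (suc e) k
        ≈⟨ q^-pair (+ binomial₂ (suc (suc k)) ℤ.* j) (+ binomial₂ k ℤ.* j) _ _ ⟩
      q^ (+ binomial₂ (suc (suc k)) ℤ.* j ℤ.+ + binomial₂ k ℤ.* j) * (P (suc (suc k)) (suc e) * P k (suc e))
        ≈⟨ *-cong (reflexive (cong q^_ (exponent-offdiagonal k j))) (P-offdiagonal k e) ⟩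
      q^ r * (Y * 1+q^ (+ suc e))
        ≈⟨ *-congˡ (distribˡ Y 1# (q^ (+ suc e))) ⟩
      q^ r * (Y * 1# + Y * q^ (+ suc e))
        ≈⟨ distribˡ _ _ _ ⟩
      q^ r * (Y * 1#) + q^ r * (Y * q^ (+ suc e))
        ≈⟨ +-cong (*-congˡ (*-identityʳ Y)) shifted ⟩
      q^ r * Y + q^ (+ suc e ℤ.+ j ℤ.+ (x′ ℤ.+ x′)) * Y′
        ≈⟨ +-cong (q^-triple j x y _ _) (q^-triple (+ suc e ℤ.+ j) x′ x′ _ _) ⟨
      q^ j * (F (ℤ.suc j) e (suc k) * F (ℤ.pred j) (suc (suc e)) (suc k))
        + q^ (+ suc e ℤ.+ j) * (F j (suc (suc e)) (suc k) * F j e (suc k)) ∎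
      where
      b : ℕ
      b  = binomial₂ (suc k)
      x y x′ r : ℤ
      x  = + b ℤ.* ℤ.suc j
      y  = + b ℤ.* ℤ.pred j
      x′ = + b ℤ.* j
      r  = j ℤ.+ (x ℤ.+ y)
      Y Y′ : Carrier
      Y  = P (suc k) e * P (suc k) (suc (suc e))
      Y′ = P (suc k) (suc (suc e)) * P (suc k) e
      regroup : ∀ C J D → (J ℤ.+ (C ℤ.* (1ℤ ℤ.+ J) ℤ.+ C ℤ.* (-1ℤ ℤ.+ J))) ℤ.+ D ≡ (D ℤ.+ J) ℤ.+ (C ℤ.* J ℤ.+ C ℤ.* J)
      regroup = solve-∀
      shifted : q^ r * (Y * q^ (+ suc e)) ≈ q^ (+ suc e ℤ.+ j ℤ.+ (x′ ℤ.+ x′)) * Y′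
      shifted = begin
        q^ r * (Y * q^ (+ suc e))
          ≈⟨ solve 4 (λ a u v z → a ⊕ ((u ⊕ v) ⊕ z) ⊜ (a ⊕ z) ⊕ (v ⊕ u)) refl _ _ _ _ ⟩
        (q^ r * q^ (+ suc e)) * Y′
          ≈⟨ *-congʳ (q^-homo r (+ suc e)) ⟨
        q^ (r ℤ.+ + suc e) * Y′
          ≡⟨ cong (λ z → q^ z * Y′) (regroup (+ b) j (+ suc e)) ⟩
        q^ (+ suc e ℤ.+ j ℤ.+ (x′ ℤ.+ x′)) * Y′ ∎

    Φ : ℤ → ℤ → ℕ → Carrier
    Φ = formula q q⁻

    formula-symmetric : ∀ i j k → Φ i j k ≡ Φ j i k
    formula-symmetric i j k = cong₂ (λ s d → F s d k) (ℤP.⊓-comm i j) (ℤP.∣i-j∣≡∣j-i∣ i j)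

    formula-above : ∀ i j d k → i ≡ + d ℤ.+ j → Φ i j k ≡ F j d k
    formula-above _ j d k ≡.refl = cong₂ (λ s m → F s m k)
      (ℤP.i≥j⇒i⊓j≡j (ℤP.i≤j⇒i≤k+j (+ d) ℤP.≤-refl)) (cong ∣_∣ ([D+J]-J≡D (+ d) j))
      where
      [D+J]-J≡D : ∀ D J → (D ℤ.+ J) ℤ.- J ≡ D
      [D+J]-J≡D = solve-∀

    formula-below : ∀ i j d k → j ≡ + d ℤ.+ i → Φ i j k ≡ F i d k
    formula-below i j d k eq = ≡.trans (formula-symmetric i j k) (formula-above j i d k eq)

    RecurrenceAt : (ℤ → ℤ → ℕ → Carrier) → ℤ → ℤ → ℕ → Set ℓ
    RecurrenceAt T i j k = T i j (suc (suc k)) * T i j k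
                           ≈ q^ j * (T i (ℤ.suc j) (suc k) * T i (ℤ.pred j) (suc k))
                             + q^ i * (T (ℤ.suc i) j (suc k) * T (ℤ.pred i) j (suc k))

    formula-recurrence-swap : ∀ i j k → RecurrenceAt Φ j i k → RecurrenceAt Φ i j k
    formula-recurrence-swap i j k rec = begin
      Φ i j (suc (suc k)) * Φ i j k
        ≡⟨ cong₂ _*_ (formula-symmetric i j _) (formula-symmetric i j k) ⟩
      Φ j i (suc (suc k)) * Φ j i k
        ≈⟨ rec ⟩
      q^ i * (Φ j (ℤ.suc i) (suc k) * Φ j (ℤ.pred i) (suc k))
        + q^ j * (Φ (ℤ.suc j) i (suc k) * Φ (ℤ.pred j) i (suc k))
        ≈⟨ +-comm _ _ ⟩
      q^ j * (Φ (ℤ.suc j) i (suc k) * Φ (ℤ.pred j) i (suc k))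
        + q^ i * (Φ j (ℤ.suc i) (suc k) * Φ j (ℤ.pred i) (suc k))
        ≡⟨ cong₂ (λ A B → q^ j * A + q^ i * B)
             (cong₂ _*_ (formula-symmetric (ℤ.suc j) i _) (formula-symmetric (ℤ.pred j) i _))
             (cong₂ _*_ (formula-symmetric j (ℤ.suc i) _) (formula-symmetric j (ℤ.pred i) _)) ⟩
      q^ j * (Φ i (ℤ.suc j) (suc k) * Φ i (ℤ.pred j) (suc k))
        + q^ i * (Φ (ℤ.suc i) j (suc k) * Φ (ℤ.pred i) j (suc k)) ∎

    formula-recurrence-diagonal : ∀ s k → RecurrenceAt Φ s s k
    formula-recurrence-diagonal s k = begin
      Φ s s (suc (suc k)) * Φ s s k
        ≡⟨ cong₂ _*_ (formula-above s s 0 (suc (suc k)) s≡0+s) (formula-above s s 0 k s≡0+s) ⟩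
      F s 0 (suc (suc k)) * F s 0 k
        ≈⟨ F-diagonal s k ⟩
      q^ s * (F s 1 (suc k) * F (ℤ.pred s) 1 (suc k)) + q^ s * (F s 1 (suc k) * F (ℤ.pred s) 1 (suc k))
        ≡⟨ cong₂ (λ A B → q^ s * A + q^ s * B)
             (cong₂ _*_ (formula-below s (ℤ.suc s) 1 (suc k) ≡.refl) (formula-above s (ℤ.pred s) 1 (suc k) s≡1+pred-s))
             (cong₂ _*_ (formula-above (ℤ.suc s) s 1 (suc k) ≡.refl) (formula-below (ℤ.pred s) s 1 (suc k) s≡1+pred-s)) ⟨
      q^ s * (Φ s (ℤ.suc s) (suc k) * Φ s (ℤ.pred s) (suc k))
        + q^ s * (Φ (ℤ.suc s) s (suc k) * Φ (ℤ.pred s) s (suc k)) ∎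
      where
      s≡0+s : s ≡ + 0 ℤ.+ s
      s≡0+s = ≡.sym (ℤP.+-identityˡ s)
      S≡1+[-1+S] : ∀ S → S ≡ 1ℤ ℤ.+ (-1ℤ ℤ.+ S)
      S≡1+[-1+S] = solve-∀
      s≡1+pred-s : s ≡ + 1 ℤ.+ ℤ.pred s
      s≡1+pred-s = S≡1+[-1+S] s

    formula-recurrence-offdiagonal : ∀ j e k → RecurrenceAt Φ (+ suc e ℤ.+ j) j k
    formula-recurrence-offdiagonal j e k = begin
      Φ i j (suc (suc k)) * Φ i j k
        ≡⟨ cong₂ _*_ (formula-above i j (suc e) (suc (suc k)) ≡.refl) (formula-above i j (suc e) k ≡.refl) ⟩
      F j (suc e) (suc (suc k)) * F j (suc e) k
        ≈⟨ F-offdiagonal j e k ⟩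
      q^ j * (F (ℤ.suc j) e (suc k) * F (ℤ.pred j) (suc (suc e)) (suc k))
        + q^ i * (F j (suc (suc e)) (suc k) * F j e (suc k))
        ≡⟨ cong₂ (λ A B → q^ j * A + q^ i * B)
             (cong₂ _*_ (formula-above i (ℤ.suc j) e (suc k) ([1+E]+J≡E+[1+J] (+ e) j))
                        (formula-above i (ℤ.pred j) (suc (suc e)) (suc k) ([1+E]+J≡[2+E]+[J-1] (+ e) j)))
             (cong₂ _*_ (formula-above (ℤ.suc i) j (suc (suc e)) (suc k) (1+[1+E]+J≡[2+E]+J (+ e) j))
                        (formula-above (ℤ.pred i) j e (suc k) (-1+[1+E]+J≡E+J (+ e) j))) ⟨
      q^ j * (Φ i (ℤ.suc j) (suc k) * Φ i (ℤ.pred j) (suc k))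
        + q^ i * (Φ (ℤ.suc i) j (suc k) * Φ (ℤ.pred i) j (suc k)) ∎
      where
      i : ℤ
      i = + suc e ℤ.+ j
      [1+E]+J≡E+[1+J] : ∀ E J → (1ℤ ℤ.+ E) ℤ.+ J ≡ E ℤ.+ (1ℤ ℤ.+ J)
      [1+E]+J≡E+[1+J] = solve-∀
      [1+E]+J≡[2+E]+[J-1] : ∀ E J → (1ℤ ℤ.+ E) ℤ.+ J ≡ (1ℤ ℤ.+ (1ℤ ℤ.+ E)) ℤ.+ (-1ℤ ℤ.+ J)
      [1+E]+J≡[2+E]+[J-1] = solve-∀
      1+[1+E]+J≡[2+E]+J : ∀ E J → 1ℤ ℤ.+ ((1ℤ ℤ.+ E) ℤ.+ J) ≡ (1ℤ ℤ.+ (1ℤ ℤ.+ E)) ℤ.+ J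
      1+[1+E]+J≡[2+E]+J = solve-∀
      -1+[1+E]+J≡E+J : ∀ E J → -1ℤ ℤ.+ ((1ℤ ℤ.+ E) ℤ.+ J) ≡ E ℤ.+ J
      -1+[1+E]+J≡E+J = solve-∀

    formula-recurrence : ∀ i j k → RecurrenceAt Φ i j k
    formula-recurrence i j k with offset-trichotomy i j
    ... | inj₁ ≡.refl                = formula-recurrence-diagonal i k
    ... | inj₂ (inj₁ (e , ≡.refl)) = formula-recurrence-offdiagonal j e k
    ... | inj₂ (inj₂ (e , ≡.refl)) = formula-recurrence-swap i j k (formula-recurrence-offdiagonal i e k)

    solution-unique : ∀ {T U : ℤ → ℤ → ℕ → Carrier} →
                      (∀ i j k x y → T i j k * x ≈ T i j k * y → x ≈ y) →
                      (∀ i j → T i j 0 ≈ U i j 0) → (∀ i j → T i j 1 ≈ U i j 1) →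
                      (∀ i j k → RecurrenceAt T i j k) → (∀ i j k → RecurrenceAt U i j k) →
                      ∀ i j k → T i j k ≈ U i j k
    solution-unique {T} {U} cancel T≈U₀ T≈U₁ recT recU = agree
      where
      agree : ∀ i j k → T i j k ≈ U i j k
      agree i j zero          = T≈U₀ i j
      agree i j (suc zero)    = T≈U₁ i j
      agree i j (suc (suc k)) = cancel i j k _ _ (begin
        T i j k * T i j (suc (suc k))
          ≈⟨ *-comm _ _ ⟩
        T i j (suc (suc k)) * T i j k
          ≈⟨ recT i j k ⟩
        q^ j * (T i (ℤ.suc j) (suc k) * T i (ℤ.pred j) (suc k))
          + q^ i * (T (ℤ.suc i) j (suc k) * T (ℤ.pred i) j (suc k))
          ≈⟨ +-cong (*-congˡ (*-cong (agree _ _ _) (agree _ _ _))) (*-congˡ (*-cong (agree _ _ _) (agree _ _ _))) ⟩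
        q^ j * (U i (ℤ.suc j) (suc k) * U i (ℤ.pred j) (suc k))
          + q^ i * (U (ℤ.suc i) j (suc k) * U (ℤ.pred i) j (suc k))
          ≈⟨ recU i j k ⟨
        U i j (suc (suc k)) * U i j k
          ≈⟨ *-congˡ (agree i j k) ⟨
        U i j (suc (suc k)) * T i j k
          ≈⟨ *-comm _ _ ⟩
        T i j k * U i j (suc (suc k)) ∎)

lemma3p7 : {c ℓ : Level} (R : CommutativeRing c ℓ) →
    let open CommutativeRing R in
    (q q⁻ : Carrier) → q * q⁻ ≈ 1# →
    (T : ℤ → ℤ → ℕ → Carrier) →
    (∀ i j k → ∀ x y → T i j k * x ≈ T i j k * y → x ≈ y) →
    (∀ i j → T i j 0 ≈ 1#) →
    (∀ i j → T i j 1 ≈ 1#) →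
    (∀ i j k → T i j (suc (suc k)) * T i j k
                 ≈ Ring.zpow R q q⁻ j * (T i (ℤ.suc j) (suc k) * T i (ℤ.pred j) (suc k))
                   + Ring.zpow R q q⁻ i * (T (ℤ.suc i) j (suc k) * T (ℤ.pred i) j (suc k))) →
    ∀ i j k → T i j k ≈ Ring.formula R q q⁻ i j k
lemma3p7 R q q⁻ q*q⁻≈1 T cancel T₀≈1 T₁≈1 recT =
  solution-unique R q q⁻ q*q⁻≈1 cancel
    (λ i j → trans (T₀≈1 i j) (sym (F-initial R q q⁻ q*q⁻≈1 (i ⊓ j) ∣ i ℤ.- j ∣ z≤n)))
    (λ i j → trans (T₁≈1 i j) (sym (F-initial R q q⁻ q*q⁻≈1 (i ⊓ j) ∣ i ℤ.- j ∣ (s≤s z≤n))))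
    recT (formula-recurrence R q q⁻ q*q⁻≈1)
  where open CommutativeRing R using (trans; sym)
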